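{- With the notation below, assume there exists $i_0\in I$ such that for all $i\in I$ we have $\Sigma(L/K)\cup\Sigma_{i_0}\cup\Sigma_i\neq\Omega_K$. Then the group $\mathrm{Sh}(E,\sigma)$ is trivial, and therefore $\mathrm{Sh}(E',\sigma)$ is trivial.
   Context: Let $K$ be a global field of characteristic $\neq2$, $\Omega_K$ its set of places, and $L$ either $K$ or a quadratic extension of $K$. Let $E$ be a commutative étale $L$-algebra with a $K$-linear involution $\sigma$ whose fixed field in $L$ is $K$. Write $E=E_1\times\cdots\times E_m$ with $\sigma(E_i)=E_i$, each $E_i$ being either a field stable under $\sigma$ or a product of two fields exchanged by $\sigma$, and let $F_i=E_i^\sigma$; assume each $E_i$ is either $K$, or $F_i\times F_i$, or a quadratic field extension of $F_i$. Let $I=\{1,\dots,m\}$. For $i\in I$ let $\Sigma_i$ be the set of places $v$ such that all places of $F_i$ above $v$ split in $E_i$ if $E_i/F_i$ is a quadratic field extension, and $\Sigma_i=\Omega_K$ otherwise. Let $\Sigma(L/K)$ be the set of places of $K$ split in $L$ if $L\neq K$, and $\emptyset$ if $L=K$. For a finite index set $J$ and $x\in(\mathbb Z/2\mathbb Z)^J$ put $J_0(x)=\{i:x_i=0\}$, $J_1(x)=\{i:x_i=1\}$; let $S_J$ be the set of $x$ with $\Sigma(L/K)\cup\bigcap_{i\in J_0(x)}\Sigma_i\cup\bigcap_{j\in J_1(x)}\Sigma_j=\Omega_K$ (empty intersection $=\Omega_K$), together with the all-$0$ and all-$1$ vectors, modulo the equivalence $x\sim x+(1,\dots,1)$. Then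 $\mathrm{Sh}(E,\sigma)=S_I/\!\sim$, a subgroup of $(\mathbb Z/2\mathbb Z)^I/\langle(1,\dots,1)\rangle$, and $\mathrm{Sh}(E',\sigma)=S_{I'}/\!\sim$ where $I'\subseteq I$ is the set of indices $i$ with $E_i/F_i$ a quadratic field extension ($\mathrm{Sh}(E',\sigma)=0$ if $I'=\emptyset$). Trivial means consisting only of the class of $(0,\dots,0)$. -}

module Defs where

open import Data.Nat using (ℕ)
open import Data.Bool using (Bool; true; false; not)
open import Data.Fin using (Fin)
open import Data.Product using (Σ; _×_; proj₁)
open import Data.Sum using (_⊎_)
open import Data.Unit using (⊤)
open import Relation.Nullary using (¬_)
open import Relation.Binary.PropositionalEquality using (_≡_)

-- Type of the factor E_i of E = E_1 × ⋯ × E_m (relative to F_i = E_i^σ):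
--   base  : E_i = K
--   split : E_i = F_i × F_i
--   quadField : E_i / F_i a quadratic field extension
data Kind : Set where
  base split quadField : Kind

-- Σ_i : the set of places v (elements of the place set Ω) such that all places
-- of F_i above v split in E_i when E_i/F_i is a quadratic field extension
-- (given abstractly as the predicate P), and Σ_i = Ω_K otherwise.
SigmaOfKind : {Ω : Set} → Kind → (Ω → Set) → Ω → Set
SigmaOfKind base  P v = ⊤
SigmaOfKind split P v = ⊤
SigmaOfKind quadField P v = P v

Sigma : {Ω : Set} {m : ℕ} → (Fin m → Kind) → (Fin m → Ω → Set) → Fin m → Ω → Set
Sigma kind ΣF i = SigmaOfKind (kind i) (ΣF i)

I′ : {m : ℕ} → (Fin m → Kind) → Set
I′ {m} kind = Σ (Fin m) (λ i → kind i ≡ quadField)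

-- Membership of x ∈ (ℤ/2ℤ)^J (encoded as J → Bool, true = 1) in S_J,
-- for Σ(L/K) = ΣL and the family (Σ_j)_{j ∈ J}:
-- x is all-0, or all-1, or Σ(L/K) ∪ ⋂_{J₀(x)} Σ_i ∪ ⋂_{J₁(x)} Σ_j = Ω_K.
InS : {Ω J : Set} → (Ω → Set) → (J → Ω → Set) → (J → Bool) → Set
InS {Ω} {J} ΣL Sig x =
  (∀ j → x j ≡ false) ⊎ (∀ j → x j ≡ true) ⊎
  (∀ (v : Ω) → ΣL v ⊎ ((∀ i → x i ≡ false → Sig i v) ⊎ (∀ j → x j ≡ true → Sig j v)))

_∼_ : {J : Set} → (J → Bool) → (J → Bool) → Set
x ∼ y = (∀ j → x j ≡ y j) ⊎ (∀ j → x j ≡ not (y j))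

-- Sh = S_J/∼ is trivial: every element of S_J is equivalent to (0,…,0).
ShTrivial : {Ω J : Set} → (Ω → Set) → (J → Ω → Set) → Set
ShTrivial {Ω} {J} ΣL Sig = ∀ (x : J → Bool) → InS ΣL Sig x → x ∼ (λ _ → false)

{-# OPTIONS --safe #-}
module Submission where

open import Defs
open import Data.Nat using (ℕ)
open import Data.Fin using (Fin)
open import Data.Product using (Σ; _×_; proj₁; _,_)
open import Data.Sum using (_⊎_; inj₁; inj₂; map₂; swap)
open import Data.Bool using (Bool; true; false)
open import Data.Unit using (tt)
open import Data.Empty using (⊥-elim)
open import Relation.Nullary using (¬_)
open import Relation.Binary.PropositionalEquality using (_≡_; refl)

-- If x ∈ S_J is not constant, pick i with x i = 0 and j with x j = 1: the covering
-- Σ(L/K) ∪ ⋂_{J₀(x)} Σ ∪ ⋂_{J₁(x)} Σ = Ω_K then forces Σ(L/K) ∪ Σ_i ∪ Σ_j = Ω_K.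
-- An index i₀ whose Σ covers Ω_K with no Σ_i therefore makes every x ∈ S_J constant.
-- Such i₀ lies in I′, since otherwise Σ_{i₀} = Ω_K already covers with itself, so the
-- same argument applies to the subfamily indexed by I′.

module _ {Ω J : Set} (ΣL : Ω → Set) (Sig : J → Ω → Set) where

  Covers : J → J → Set
  Covers i j = ∀ v → ΣL v ⊎ (Sig i v ⊎ Sig j v)

  covers-sym : ∀ {i j} → Covers i j → Covers j i
  covers-sym c v = map₂ swap (c v)

  covers-of-disagreement : {x : J → Bool} →
    (∀ v → ΣL v ⊎ ((∀ i → x i ≡ false → Sig i v) ⊎ (∀ j → x j ≡ true → Sig j v))) →
    ∀ {i j} → x i ≡ false → x j ≡ true → Covers i j
  covers-of-disagreement c xi≡0 xj≡1 v with c v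
  ... | inj₁ l         = inj₁ l
  ... | inj₂ (inj₁ s₀) = inj₂ (inj₁ (s₀ _ xi≡0))
  ... | inj₂ (inj₂ s₁) = inj₂ (inj₂ (s₁ _ xj≡1))

  IsAnchor : J → Set
  IsAnchor i₀ = ∀ i → ¬ Covers i₀ i

  agrees-with-anchor : ∀ {i₀} {x : J → Bool} → IsAnchor i₀ →
    (∀ v → ΣL v ⊎ ((∀ i → x i ≡ false → Sig i v) ⊎ (∀ j → x j ≡ true → Sig j v))) →
    ∀ j → x j ≡ x i₀
  agrees-with-anchor {i₀} {x} anchor c j with x i₀ in e₀ | x j in e
  ... | false | false = refl
  ... | true  | true  = refl
  ... | false | true  = ⊥-elim (anchor j (covers-of-disagreement c e₀ e))
  ... | true  | false = ⊥-elim (anchor j (covers-sym (covers-of-disagreement c e e₀)))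

  constant-∼-zero : ∀ {x : J → Bool} b → (∀ j → x j ≡ b) → x ∼ (λ _ → false)
  constant-∼-zero false x≡0 = inj₁ x≡0
  constant-∼-zero true  x≡1 = inj₂ x≡1

  shTrivial-of-anchor : ∀ i₀ → IsAnchor i₀ → ShTrivial ΣL Sig
  shTrivial-of-anchor i₀ anchor x (inj₁ x≡0)         = inj₁ x≡0
  shTrivial-of-anchor i₀ anchor x (inj₂ (inj₁ x≡1))  = inj₂ x≡1
  shTrivial-of-anchor i₀ anchor x (inj₂ (inj₂ c))    =
    constant-∼-zero (x i₀) (agrees-with-anchor anchor c)

anchor-isQuadField : {Ω : Set} {m : ℕ} (ΣL : Ω → Set) (kind : Fin m → Kind) (ΣF : Fin m → Ω → Set) →
  ∀ {i₀} → IsAnchor ΣL (Sigma kind ΣF) i₀ → kind i₀ ≡ quadField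
anchor-isQuadField ΣL kind ΣF {i₀} anchor with kind i₀ in e
... | base      = ⊥-elim (anchor i₀ λ v → inj₂ (inj₁ tt))
... | split     = ⊥-elim (anchor i₀ λ v → inj₂ (inj₁ tt))
... | quadField = refl

lemma9p2p3 : {Ω : Set} (m : ℕ) (ΣL : Ω → Set) (kind : Fin m → Kind) (ΣF : Fin m → Ω → Set) →
    Σ (Fin m) (λ i₀ → ∀ (i : Fin m) → ¬ (∀ (v : Ω) → ΣL v ⊎ (Sigma kind ΣF i₀ v ⊎ Sigma kind ΣF i v))) →
    ShTrivial ΣL (Sigma kind ΣF) × ShTrivial {Ω} {I′ kind} ΣL (λ p → Sigma kind ΣF (proj₁ p))
lemma9p2p3 m ΣL kind ΣF (i₀ , anchor) =
  shTrivial-of-anchor ΣL (Sigma kind ΣF) i₀ anchor ,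
  shTrivial-of-anchor ΣL (λ p → Sigma kind ΣF (proj₁ p)) i₀′ (λ j → anchor (proj₁ j))
  where
  i₀′ : I′ kind
  i₀′ = i₀ , anchor-isQuadField ΣL kind ΣF anchor
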